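{- Let $\alpha\in\mathbb{Z}^S\setminus\{0\}$ and let $k,f$ be positive integers coprime to all primes in $S$. If $\frac{k}{\mathrm{rad}\,k}\nmid\alpha$ then $c_{k,f}(\alpha)=0$; if $\frac{k}{\mathrm{rad}\,k}\mid\alpha$ then $|c_{k,f}(\alpha)|\le k^{3/2}f\sqrt{\gcd(kf^2,\alpha)}$. Here $\mathrm{rad}\,a=\prod_{\ell\mid a}\ell$.
   Context: $S=\{\infty,q_1,\dots,q_r\}$, $q_i$ distinct primes, $2\in S$; $\mathbb{Z}^S=\{\alpha\in\mathbb{Q}:v_\ell(\alpha)\ge0\ \forall\ell\notin S\}$. For $d$ a positive integer coprime to $S$, "$d\mid\alpha$" means $\alpha/d\in\mathbb{Z}^S$, and $\gcd(kf^2,\alpha)=\prod_{\ell\notin S}\ell^{\min(v_\ell(\alpha),v_\ell(kf^2))}$. For a positive integer $a$ and prime $\ell$: $a_{(\ell)}=\ell^{v_\ell(a)}$, $a^{(\ell)}=a/a_{(\ell)}$, $(a^{(\ell)})^{ -1}$ an inverse of $a^{(\ell)}$ modulo $a_{(\ell)}$. $\phi$ is Euler's totient, $\left(\frac{\cdot}{\ell^j}\right)=\left(\frac{\cdot}{\ell}\right)^j$ (Legendre symbol of an $\ell$-adic unit's residue; $1$ if $j=0$), $\kappa(M)=1$ if $M\equiv1\ (4)$ and $i$ if $M\equiv3\ (4)$. For a prime $\ell\notin S$, integers $u,v\ge0$, $\alpha\in\mathbb{Z}_\ell\setminus\{0\}$, $w=\min\{v_\ell(\alpha),u+2v\}$: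 $c^{(\ell)}_{\ell^u,\ell^v}(\alpha)=\ell^{\frac{u+2v+w}2}\kappa(\ell^{u+2v-w})\left(\frac{\ell^{ -v_\ell(\alpha)}\alpha}{\ell^{u+2v-w}}\right)\cdot\varepsilon$ with $\varepsilon=\phi(\ell^u)$ if $v_\ell(\alpha)\ge u$, $u$ even; $\varepsilon=-\ell^{u-1}$ if $v_\ell(\alpha)=u-1$, $u$ even; $\varepsilon=\left(\frac{ -\ell^{ -v_\ell(\alpha)}\alpha}{\ell}\right)$ if $v_\ell(\alpha)=u-1$, $u$ odd; $\varepsilon=0$ otherwise. Finally $c_{k,f}(\alpha)=\prod_{\ell\notin S}c^{(\ell)}_{k_{(\ell)},f_{(\ell)}}\bigl(((kf^2)^{(\ell)})^{ -1}\alpha\bigr)$. -}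

module Defs where

open import Data.Bool using (Bool; true; false; if_then_else_; _∧_; not)
open import Data.Nat as ℕ using (ℕ; zero; suc; _+_; _*_; _∸_; _^_; _≤_; _⊓_; _%_)
open import Data.Nat.Divisibility using (_∣_; _∣?_)
open import Data.Nat.DivMod using (_/_)
open import Data.Nat.Primality using (Prime; prime?)
open import Data.Nat.Coprimality using (coprime?)
open import Data.Integer as ℤ using (ℤ; +_; -_; ∣_∣; sign; _◃_)
open import Data.Rational as ℚ using (ℚ; ↥_; ↧ₙ_)
open import Data.List using (List; []; _∷_; filter; upTo; applyUpTo; length; foldr; map)
open import Data.List.Membership.DecPropositional ℕ._≟_ using (_∈?_; _∉_)
open import Relation.Nullary using (does; ¬_)
open import Relation.Nullary.Decidable using (⌊_⌋; _×-dec_; ¬?)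

-- division with the convention a / 0 = 0 (only ever used with nonzero divisors)
divN : ℕ → ℕ → ℕ
divN a zero    = 0
divN a (suc b) = a / suc b

-- ℓ-adic valuation of a natural number (v ℓ 0 = 0 by convention; ℓ ≥ 2 intended)
valF : ℕ → ℕ → ℕ → ℕ
valF zero       ℓ n = 0
valF (suc fuel) ℓ n =
  if ⌊ ℓ ℕ.≤? 1 ⌋ then 0
  else if ⌊ n ℕ.≟ 0 ⌋ then 0
  else if ⌊ ℓ ∣? n ⌋ then suc (valF fuel ℓ (divN n ℓ))
  else 0

val : ℕ → ℕ → ℕ
val ℓ n = valF n ℓ n

-- ℓ-adic valuation of a rational α at a prime ℓ not dividing its denominator
-- (for such ℓ, v_ℓ(α) = v_ℓ((↥ α)) ≥ 0)
valQ : ℕ → ℚ → ℕ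
valQ ℓ α = val ℓ ∣ (↥ α) ∣

totient : ℕ → ℕ
totient n = length (filter (λ x → coprime? x n) (applyUpTo suc n))

-- least x ∈ [0, m) with a·x ≡ 1 (mod m), or 0 if none: "an inverse of a modulo m"
invMod : ℕ → ℕ → ℕ
invMod m a with filter (λ x → m ∣? ∣ (+ (a * x)) ℤ.- (+ 1) ∣) (upTo m)
... | []    = 0
... | x ∷ _ = x

isSquareMod : ℕ → ℤ → Bool
isSquareMod ℓ x = foldr (λ y b → ⌊ ℓ ∣? ∣ (+ (y * y)) ℤ.- x ∣ ⌋ Data.Bool.∨ b) false (upTo ℓ)
  where import Data.Bool

legendre : ℕ → ℤ → ℤ
legendre ℓ x =
  if ⌊ ℓ ∣? ∣ x ∣ ⌋ then + 0
  else if isSquareMod ℓ x then + 1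
  else - (+ 1)

-- Values of c: numbers of the shape  i^e · m · √r  (m ∈ ℤ, r ∈ ℕ).
-- Since √r₁·√r₂ = √(r₁r₂) for r₁,r₂ ≥ 0, these are closed under products.

record Val : Set where
  constructor val⟨_,_,_⟩
  field
    iexp  : ℕ
    coeff : ℤ
    rad   : ℕ

open Val public

oneV : Val
oneV = val⟨ 0 , + 1 , 1 ⟩

_*V_ : Val → Val → Val
val⟨ e₁ , m₁ , r₁ ⟩ *V val⟨ e₂ , m₂ , r₂ ⟩ = val⟨ (e₁ + e₂) % 4 , m₁ ℤ.* m₂ , r₁ * r₂ ⟩

IsZero : Val → Set
IsZero v = coeff v ≡ + 0 ⊎ rad v ≡ 0
  where
  open import Relation.Binary.PropositionalEquality using (_≡_)
  open import Data.Sum using (_⊎_)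

absSq : Val → ℕ
absSq v = ∣ coeff v ∣ * ∣ coeff v ∣ * rad v

-- The local factor c^{(ℓ)}_{ℓ^u,ℓ^v}(β), where β is an ℓ-adic nonzero number
-- given by its valuation vβ = v_ℓ(β) and an integer γ congruent mod ℓ to the
-- ℓ-adic unit ℓ^{-vβ} β (the Legendre symbols only depend on γ mod ℓ).

localC : (ℓ u v vβ : ℕ) (γ : ℤ) → Val
localC ℓ u v vβ γ = val⟨ κe , leg ℤ.* ε , ℓ ^ (u + 2 * v + w) ⟩
  where
  w : ℕ
  w = vβ ⊓ (u + 2 * v)
  j : ℕ
  j = u + 2 * v ∸ w
  -- κ(ℓ^j) = 1 if ℓ^j ≡ 1 (mod 4), i if ℓ^j ≡ 3 (mod 4)
  κe : ℕ
  κe = if ⌊ (ℓ ^ j) % 4 ℕ.≟ 1 ⌋ then 0 else 1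
  leg : ℤ
  leg = legendre ℓ γ ℤ.^ j
  ε : ℤ
  ε = if ⌊ u % 2 ℕ.≟ 0 ⌋
        then (if ⌊ u ℕ.≤? vβ ⌋ then + totient (ℓ ^ u)
              else if ⌊ vβ + 1 ℕ.≟ u ⌋ then - (+ (ℓ ^ (u ∸ 1)))
              else + 0)
        else (if ⌊ vβ + 1 ℕ.≟ u ⌋ then legendre ℓ (- γ) else + 0)

unitPart : ℕ → ℕ → ℤ → ℤ
unitPart ℓ e n = sign n ◃ divN ∣ n ∣ (ℓ ^ e)

-- the factor of c_{k,f}(α) at the prime ℓ:
--   c^{(ℓ)}_{k_(ℓ), f_(ℓ)}( ((kf²)^{(ℓ)})^{-1} α )
cLocal : ℕ → ℕ → ℕ → ℚ → Val
cLocal ℓ k f α = localC ℓ u v vα γ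
  where
  u  = val ℓ k
  v  = val ℓ f
  N  = k * f * f
  M  = divN N (ℓ ^ (u + 2 * v))
  Mi = invMod (ℓ ^ (u + 2 * v)) M
  vα = valQ ℓ α                        -- v_ℓ(M⁻¹ α) = v_ℓ(α)
  -- residue mod ℓ of the ℓ-adic unit ℓ^{-vα} M⁻¹ α
  γ  = unitPart ℓ vα ((↥ α)) ℤ.* (+ Mi) ℤ.* (+ invMod ℓ ((↧ₙ α)))

primesOutside : List ℕ → ℕ → List ℕ
primesOutside S n = filter (λ ℓ → prime? ℓ ×-dec ¬? (ℓ ∈? S)) (upTo (suc n))

-- c_{k,f}(α) = ∏_{ℓ ∉ S} c^{(ℓ)}_{k_(ℓ),f_(ℓ)}(((kf²)^{(ℓ)})^{-1} α).
-- Primes ℓ ∤ kf contribute the factor 1, so the product is taken over ℓ ≤ kf.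
cKF : List ℕ → ℕ → ℕ → ℚ → Val
cKF S k f α = foldr (λ ℓ acc → cLocal ℓ k f α *V acc) oneV (primesOutside S (k * f))

InZS : List ℕ → ℚ → Set
InZS S α = ∀ ℓ → Prime ℓ → ℓ ∉ S → ¬ (ℓ ∣ (↧ₙ α))

DivS : List ℕ → ℕ → ℚ → Set
DivS S zero    α = Data.Empty.⊥
  where import Data.Empty
DivS S (suc d) α = InZS S (α ℚ.* ((+ 1) ℚ./ suc d))

gcdS : List ℕ → ℕ → ℕ → ℚ → ℕ
gcdS S k f α = foldr (λ ℓ acc → ℓ ^ (valQ ℓ α ⊓ val ℓ (k * f * f)) * acc) 1
                     (primesOutside S (k * f * f))

radical : ℕ → ℕ
radical a = foldr _*_ 1 (filter (λ ℓ → prime? ℓ ×-dec (ℓ ∣? a)) (upTo (suc a)))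

-- With
-- u = v_ℓ(k), v = v_ℓ(f) and w = min(v_ℓ(α), u + 2v), the local factor is
-- i^e · (Legendre symbol)^j · ε · √(ℓ^(u+2v+w)) with |ε| ≤ ℓ^u, so its squared modulus is at
-- most ℓ^(3u) ℓ^(2v) ℓ^w; multiplying over ℓ gives |c_{k,f}(α)|² ≤ k³ f² gcd(kf², α), even
-- without the divisibility hypothesis.
-- The factor vanishes as soon as u ≥ v_ℓ(α) + 2. Otherwise u ≤ v_ℓ(α) + 1 for every ℓ ∉ S,
-- and since v_ℓ(k / rad k) = u − 1 for ℓ ∣ k, the number k / rad k divides α in ℤ^S.

module Submission where

open import Defs
open import Data.Bool using (true; false; if_then_else_)
open import Data.Integer as ℤ using (ℤ; +_; -_; ∣_∣)
import Data.Integer.Properties as ℤₚ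
open import Data.Integer.GCD using (gcd)
open import Data.List using (List; []; _∷_; _++_; [_]; _∷ʳ_; foldr; filter; upTo; applyUpTo)
open import Data.List.Properties
  using (upTo-∷ʳ; ++-assoc; ++-identityʳ; filter-++; length-filter; length-applyUpTo)
open import Data.List.Membership.Propositional using (_∈_; _∉_)
open import Data.List.Membership.Propositional.Properties using (∈-filter⁺; ∈-upTo⁺)
open import Data.List.Relation.Unary.All as All using (All; []; _∷_)
open import Data.List.Relation.Unary.All.Properties using (all-filter; ¬Any⇒All¬)
open import Data.List.Relation.Unary.Any as Any using (Any; here; there; any?)
open import Data.List.Relation.Unary.Unique.Propositional using (Unique; _∷_)
import Data.List.Relation.Unary.Unique.Propositional.Properties as Unique
open import Data.Nat as ℕ
  using (ℕ; zero; suc; _+_; _*_; _∸_; _^_; _≤_; _<_; _⊓_; _%_; z≤n; s≤s; z<s; NonZero; _≤?_; _<?_; _≟_)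
open import Data.Nat.Properties
open import Data.List.Membership.DecPropositional _≟_ using (_∈?_)
open import Data.Nat.Coprimality using (Coprime; coprime?; recompute)
open import Data.Nat.Divisibility
open import Data.Nat.DivMod using (m/n*n≡m)
open import Data.Nat.Primality
  using (Prime; prime?; euclidsLemma; prime⇒nonZero; prime⇒nonTrivial; prime⇒irreducible; ¬prime[1])
open import Data.Nat.Tactic.RingSolver using (solve-∀)
open import Data.Product using (_×_; _,_; proj₁; proj₂; ∃-syntax)
open import Data.Rational as ℚ using (ℚ; 0ℚ; ↥_; ↧ₙ_)
import Data.Rational.Properties as ℚₚ
open import Data.Sum using (inj₁; inj₂)
open import Function using (_∘_)
open import Relation.Binary.PropositionalEquality hiding ([_])
open import Relation.Nullary using (¬_; yes; no; contradiction)
open import Relation.Nullary.Decidable using (⌊_⌋; _×-dec_; ¬?)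

-- Valuations

divN*≡ : ∀ {d n} → d ∣ n → divN n d * d ≡ n
divN*≡ {zero}  0∣n = sym (0∣⇒≡0 0∣n)
divN*≡ {suc d} d∣n = m/n*n≡m d∣n

^valF∣ : ∀ fuel ℓ n → ℓ ^ valF fuel ℓ n ∣ n
^valF∣ zero       ℓ n = 1∣ n
^valF∣ (suc fuel) ℓ n with ⌊ ℓ ≤? 1 ⌋ | ⌊ n ≟ 0 ⌋ | ℓ ∣? n
... | true  | _     | _       = 1∣ n
... | false | true  | _       = 1∣ n
... | false | false | no _    = 1∣ n
... | false | false | yes ℓ∣n =
  subst (ℓ ^ suc (valF fuel ℓ (divN n ℓ)) ∣_) (trans (*-comm ℓ _) (divN*≡ ℓ∣n))
        (*-monoʳ-∣ ℓ (^valF∣ fuel ℓ (divN n ℓ)))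

^val∣ : ∀ ℓ n → ℓ ^ val ℓ n ∣ n
^val∣ ℓ n = ^valF∣ n ℓ n

^∣⇒≤valF : ∀ fuel {ℓ n e} → 1 < ℓ → .{{NonZero n}} → n ≤ fuel → ℓ ^ e ∣ n → e ≤ valF fuel ℓ n
^∣⇒≤valF _          {e = zero}  _ _ _ = z≤n
^∣⇒≤valF zero       {n = n} {suc _} _ n≤0 _ = contradiction (n≤0⇒n≡0 n≤0) (ℕ.≢-nonZero⁻¹ n)
^∣⇒≤valF (suc fuel) {ℓ} {n} {suc e} 1<ℓ n≤1+fuel ℓ^[1+e]∣n with ℓ ≤? 1 | n ≟ 0 | ℓ ∣? n
... | yes ℓ≤1 | _       | _       = contradiction ℓ≤1 (<⇒≱ 1<ℓ)
... | no _    | yes n≡0 | _       = contradiction n≡0 (ℕ.≢-nonZero⁻¹ n)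
... | no _    | no _    | no ℓ∤n  = contradiction (∣-trans (m∣m*n (ℓ ^ e)) ℓ^[1+e]∣n) ℓ∤n
... | no _    | no _    | yes ℓ∣n = s≤s (^∣⇒≤valF fuel 1<ℓ q≤fuel ℓ^e∣q)
  where
  q = divN n ℓ
  q*ℓ≡n : q * ℓ ≡ n
  q*ℓ≡n = divN*≡ ℓ∣n
  q≢0 : q ≢ 0
  q≢0 q≡0 = ℕ.≢-nonZero⁻¹ n (trans (sym q*ℓ≡n) (cong (_* ℓ) q≡0))
  instance
    ℓ≢0 = ℕ.>-nonZero (<-trans z<s 1<ℓ)
    q≢0′ = ℕ.≢-nonZero q≢0
  q≤fuel : q ≤ fuel
  q≤fuel = ≤-pred (≤-trans (subst (q <_) q*ℓ≡n (m<m*n q ℓ 1<ℓ)) n≤1+fuel)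
  ℓ^e∣q : ℓ ^ e ∣ q
  ℓ^e∣q = *-cancelˡ-∣ ℓ (subst (ℓ * ℓ ^ e ∣_) (sym (trans (*-comm ℓ q) q*ℓ≡n)) ℓ^[1+e]∣n)

^∣⇒≤val : ∀ {ℓ n e} → 1 < ℓ → .{{NonZero n}} → ℓ ^ e ∣ n → e ≤ val ℓ n
^∣⇒≤val {n = n} 1<ℓ = ^∣⇒≤valF n 1<ℓ ≤-refl

val-*-≥ : ∀ {ℓ} m n → 1 < ℓ → .{{NonZero (m * n)}} → val ℓ m + val ℓ n ≤ val ℓ (m * n)
val-*-≥ {ℓ} m n 1<ℓ = ^∣⇒≤val 1<ℓ
  (subst (_∣ m * n) (sym (^-distribˡ-+-* ℓ (val ℓ m) (val ℓ n))) (*-pres-∣ (^val∣ ℓ m) (^val∣ ℓ n)))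

^-monoʳ-∣ : ∀ ℓ {a b} → a ≤ b → ℓ ^ a ∣ ℓ ^ b
^-monoʳ-∣ ℓ {a} {b} a≤b =
  divides (ℓ ^ (b ∸ a)) (trans (cong (ℓ ^_) (sym (m+[n∸m]≡n a≤b)))
                               (trans (^-distribˡ-+-* ℓ a (b ∸ a)) (*-comm (ℓ ^ a) _)))

prime>1 : ∀ {p} → Prime p → 1 < p
prime>1 {p} pp = ℕ.nonTrivial⇒n>1 p {{prime⇒nonTrivial pp}}

prime∣^⇒≡ : ∀ {p q} e → Prime p → Prime q → p ∣ q ^ e → p ≡ q
prime∣^⇒≡ zero    pp _  p∣1 = contradiction (subst Prime (∣1⇒≡1 p∣1) pp) ¬prime[1]
prime∣^⇒≡ (suc e) pp pq p∣q^[1+e] with euclidsLemma _ _ pp p∣q^[1+e]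
... | inj₂ p∣q^e = prime∣^⇒≡ e pp pq p∣q^e
... | inj₁ p∣q with prime⇒irreducible pq p∣q
...   | inj₁ p≡1 = contradiction (subst Prime p≡1 pp) ¬prime[1]
...   | inj₂ p≡q = p≡q

prime^∣m*n⇒∣n : ∀ {p m} n a → Prime p → ¬ p ∣ m → p ^ a ∣ m * n → p ^ a ∣ n
prime^∣m*n⇒∣n n zero _ _ _ = 1∣ n
prime^∣m*n⇒∣n {p} {m} n (suc a) pp p∤m p^[1+a]∣mn
  with euclidsLemma m n pp (∣-trans (m∣m*n (p ^ a)) p^[1+a]∣mn)
... | inj₁ p∣m = contradiction p∣m p∤m
... | inj₂ (divides q refl) =
  subst (p * p ^ a ∣_) (*-comm p q) (*-monoʳ-∣ p (prime^∣m*n⇒∣n q a pp p∤m p^a∣mq))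
  where
  regroup : ∀ x y z → x * (y * z) ≡ z * (x * y)
  regroup = solve-∀
  p^a∣mq : p ^ a ∣ m * q
  p^a∣mq = *-cancelˡ-∣ p {{prime⇒nonZero pp}} (subst (p * p ^ a ∣_) (regroup m q p) p^[1+a]∣mn)

-- Products of prime powers

∏ : (ℕ → ℕ) → List ℕ → ℕ
∏ B = foldr (λ ℓ acc → B ℓ * acc) 1

∏-cong : ∀ {B C} → (∀ x → B x ≡ C x) → ∀ L → ∏ B L ≡ ∏ C L
∏-cong B≗C []      = refl
∏-cong B≗C (x ∷ L) = cong₂ _*_ (B≗C x) (∏-cong B≗C L)

∏-++ : ∀ B L M → ∏ B (L ++ M) ≡ ∏ B L * ∏ B M
∏-++ B []      M = sym (+-identityʳ (∏ B M))
∏-++ B (x ∷ L) M = trans (cong (B x *_) (∏-++ B L M)) (sym (*-assoc (B x) _ _))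

∏-pos : ∀ {B} L → All (λ x → 0 < B x) L → 0 < ∏ B L
∏-pos []      []             = z<s
∏-pos (x ∷ L) (Bx>0 ∷ BL>0) = *-mono-≤ Bx>0 (∏-pos L BL>0)

∏-mono-≤ : ∀ {B C} L → All (λ x → B x ≤ C x) L → ∏ B L ≤ ∏ C L
∏-mono-≤ []      []             = ≤-refl
∏-mono-≤ (x ∷ L) (Bx≤Cx ∷ BL≤CL) = *-mono-≤ Bx≤Cx (∏-mono-≤ L BL≤CL)

∈⇒∣∏ : ∀ B {x L} → x ∈ L → B x ∣ ∏ B L
∈⇒∣∏ B {L = _ ∷ L} (here refl)  = m∣m*n (∏ B L)
∈⇒∣∏ B {L = y ∷ _} (there x∈L) = ∣n⇒∣m*n (B y) (∈⇒∣∏ B x∈L)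

∏-monomial : ∀ A B C L →
  ∏ (λ x → A x ^ 3 * (B x * B x) * C x) L ≡ ∏ A L ^ 3 * (∏ B L * ∏ B L) * ∏ C L
∏-monomial A B C []      = refl
∏-monomial A B C (x ∷ L) rewrite ∏-monomial A B C L =
  regroup (A x) (B x) (C x) (∏ A L) (∏ B L) (∏ C L)
  where
  regroup : ∀ x y z X Y Z →
    x * (x * (x * 1)) * (y * y) * z * (X * (X * (X * 1)) * (Y * Y) * Z)
      ≡ x * X * (x * X * (x * X * 1)) * (y * Y * (y * Y)) * (z * Z)
  regroup = solve-∀

prime∤∏^ : ∀ (e : ℕ → ℕ) {p} L → Prime p → All Prime L → All (p ≢_) L → ¬ p ∣ ∏ (λ q → q ^ e q) L
prime∤∏^ e []      pp _         _           p∣1 = contradiction (subst Prime (∣1⇒≡1 p∣1) pp) ¬prime[1]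
prime∤∏^ e (q ∷ L) pp (pq ∷ pL) (p≢q ∷ p≢L) p∣∏ with euclidsLemma (q ^ e q) _ pp p∣∏
... | inj₁ p∣q^e = p≢q (prime∣^⇒≡ (e q) pp pq p∣q^e)
... | inj₂ p∣∏L = prime∤∏^ e L pp pL p≢L p∣∏L

∏^∣ : ∀ (e : ℕ → ℕ) {n} L → All Prime L → Unique L → All (λ q → q ^ e q ∣ n) L → ∏ (λ q → q ^ e q) L ∣ n
∏^∣ e {n} []      _         _           _ = 1∣ n
∏^∣ e     (p ∷ L) (pp ∷ pL) (p∉L ∷ uL) (p^e∣n ∷ L∣n) with ∏^∣ e L pL uL L∣n
... | divides m refl = *-monoˡ-∣ ∏L (prime^∣m*n⇒∣n m (e p) pp (prime∤∏^ e L pp pL p∉L) p^e∣∏L*m)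
  where
  ∏L = ∏ (λ q → q ^ e q) L
  p^e∣∏L*m : p ^ e p ∣ ∏L * m
  p^e∣∏L*m = subst (p ^ e p ∣_) (*-comm m ∏L) p^e∣n

upTo-prefix : ∀ {m n} → m ≤ n → ∃[ ys ] upTo n ≡ upTo m ++ ys
upTo-prefix {m} {zero}  z≤n = [] , refl
upTo-prefix {m} {suc n} m≤1+n with m≤n⇒m<n∨m≡n m≤1+n
... | inj₂ refl = [] , sym (++-identityʳ _)
... | inj₁ (s≤s m≤n) with upTo-prefix m≤n
...   | ys , eq =
  ys ∷ʳ n , trans (sym (upTo-∷ʳ n)) (trans (cong (_∷ʳ n) eq) (++-assoc (upTo m) ys [ n ]))

module _ (S : List ℕ) where

  private
    P? = λ ℓ → prime? ℓ ×-dec ¬? (ℓ ∈? S)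

  primesOutside-prime : ∀ n → All Prime (primesOutside S n)
  primesOutside-prime n = All.map proj₁ (all-filter P? (upTo (suc n)))

  primesOutside-unique : ∀ n → Unique (primesOutside S n)
  primesOutside-unique n = Unique.filter⁺ P? (Unique.upTo⁺ (suc n))

  ∈-primesOutside : ∀ {ℓ n} → Prime ℓ → ℓ ∉ S → ℓ ≤ n → ℓ ∈ primesOutside S n
  ∈-primesOutside pℓ ℓ∉S ℓ≤n = ∈-filter⁺ P? (∈-upTo⁺ (s≤s ℓ≤n)) (pℓ , ℓ∉S)

  ∏^-primesOutside-mono : ∀ (e : ℕ → ℕ) {m n} → m ≤ n →
    ∏ (λ q → q ^ e q) (primesOutside S m) ≤ ∏ (λ q → q ^ e q) (primesOutside S n)
  ∏^-primesOutside-mono e {m} {n} m≤n with upTo-prefix (s≤s m≤n)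
  ... | ys , upTo≡ = begin
      ∏ B (primesOutside S m)
    ≤⟨ m≤m*n (∏ B (primesOutside S m)) (∏ B (filter P? ys)) {{ℕ.>-nonZero ∏ys>0}} ⟩
      ∏ B (primesOutside S m) * ∏ B (filter P? ys)
    ≡⟨ sym (∏-++ B (primesOutside S m) (filter P? ys)) ⟩
      ∏ B (primesOutside S m ++ filter P? ys)
    ≡⟨ cong (∏ B) (sym (filter-++ P? (upTo (suc m)) ys)) ⟩
      ∏ B (filter P? (upTo (suc m) ++ ys))
    ≡⟨ cong (∏ B ∘ filter P?) (sym upTo≡) ⟩
      ∏ B (primesOutside S n) ∎
    where
    open ≤-Reasoning
    B = λ q → q ^ e q
    ∏ys>0 : 0 < ∏ B (filter P? ys)
    ∏ys>0 = ∏-pos (filter P? ys)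
      (All.map (λ {q} (pq , _) → m^n>0 q {{prime⇒nonZero pq}} (e q)) (all-filter P? ys))

module _ (n : ℕ) where

  private
    P? = λ ℓ → prime? ℓ ×-dec (ℓ ∣? n)
    L = filter P? (upTo (suc n))
    prime-divisors : All (λ ℓ → Prime ℓ × ℓ ∣ n) L
    prime-divisors = all-filter P? (upTo (suc n))

  radical∣ : radical n ∣ n
  radical∣ = subst (_∣ n) (∏-cong *-identityʳ L)
    (∏^∣ (λ _ → 1) L (All.map proj₁ prime-divisors) (Unique.filter⁺ P? (Unique.upTo⁺ (suc n)))
         (All.map (λ {q} (_ , q∣n) → subst (_∣ n) (sym (*-identityʳ q)) q∣n) prime-divisors))

  prime∣⇒∣radical : ∀ {ℓ} .{{_ : NonZero n}} → Prime ℓ → ℓ ∣ n → ℓ ∣ radical n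
  prime∣⇒∣radical pℓ ℓ∣n = ∈⇒∣∏ (λ q → q) (∈-filter⁺ P? (∈-upTo⁺ (s≤s (∣⇒≤ ℓ∣n))) (pℓ , ℓ∣n))

-- Local factors

∏V : (ℕ → Val) → List ℕ → Val
∏V F = foldr (λ ℓ acc → F ℓ *V acc) oneV

absSq-*V : ∀ a b → absSq (a *V b) ≡ absSq a * absSq b
absSq-*V a b = begin
    ∣ coeff a ℤ.* coeff b ∣ * ∣ coeff a ℤ.* coeff b ∣ * (rad a * rad b)
  ≡⟨ cong (λ x → x * x * (rad a * rad b)) (ℤₚ.abs-* (coeff a) (coeff b)) ⟩
    ∣ coeff a ∣ * ∣ coeff b ∣ * (∣ coeff a ∣ * ∣ coeff b ∣) * (rad a * rad b)
  ≡⟨ regroup ∣ coeff a ∣ ∣ coeff b ∣ (rad a) (rad b) ⟩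
    ∣ coeff a ∣ * ∣ coeff a ∣ * rad a * (∣ coeff b ∣ * ∣ coeff b ∣ * rad b) ∎
  where
  open ≡-Reasoning
  regroup : ∀ x y r s → x * y * (x * y) * (r * s) ≡ x * x * r * (y * y * s)
  regroup = solve-∀

absSq-∏V : ∀ F L → absSq (∏V F L) ≡ ∏ (absSq ∘ F) L
absSq-∏V F []      = refl
absSq-∏V F (x ∷ L) = trans (absSq-*V (F x) (∏V F L)) (cong (absSq (F x) *_) (absSq-∏V F L))

coeff-∏V-vanishes : ∀ F {L} → Any (λ x → coeff (F x) ≡ + 0) L → coeff (∏V F L) ≡ + 0
coeff-∏V-vanishes F {x ∷ L} (here Fx≡0) =
  trans (cong (ℤ._* coeff (∏V F L)) Fx≡0) (ℤₚ.*-zeroˡ (coeff (∏V F L)))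
coeff-∏V-vanishes F {x ∷ L} (there some) =
  trans (cong (coeff (F x) ℤ.*_) (coeff-∏V-vanishes F some)) (ℤₚ.*-zeroʳ (coeff (F x)))

if-elim : ∀ {A : Set} (P : A → Set) b {x y} → P x → P y → P (if b then x else y)
if-elim P true  Px _  = Px
if-elim P false _  Py = Py

-- The factor ε of localC (local to its where-block in Defs); coeff (localC ℓ u v vβ γ)
-- unfolds to legendre ℓ γ ℤ.^ j ℤ.* localε ℓ u vβ γ.
localε : ℕ → ℕ → ℕ → ℤ → ℤ
localε ℓ u vβ γ =
  if ⌊ u % 2 ≟ 0 ⌋
    then (if ⌊ u ≤? vβ ⌋ then + totient (ℓ ^ u)
          else if ⌊ vβ + 1 ≟ u ⌋ then - (+ (ℓ ^ (u ∸ 1)))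
          else + 0)
    else (if ⌊ vβ + 1 ≟ u ⌋ then legendre ℓ (- γ) else + 0)

localε-vanishes : ∀ ℓ {u vβ} γ → suc vβ < u → localε ℓ u vβ γ ≡ + 0
localε-vanishes ℓ {u} {vβ} γ 1+vβ<u with u ≤? vβ | vβ + 1 ≟ u
... | yes u≤vβ | _          = contradiction u≤vβ (<⇒≱ (<-trans (n<1+n vβ) 1+vβ<u))
... | no _     | yes vβ+1≡u = contradiction (trans (+-comm 1 vβ) vβ+1≡u) (<⇒≢ 1+vβ<u)
... | no _     | no _       = if-elim (_≡ + 0) ⌊ u % 2 ≟ 0 ⌋ refl refl

totient≤ : ∀ n → totient n ≤ n
totient≤ n = ≤-trans (length-filter (λ x → coprime? x n) (applyUpTo suc n))
                     (≤-reflexive (length-applyUpTo suc n))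

∣legendre∣≤1 : ∀ ℓ x → ∣ legendre ℓ x ∣ ≤ 1
∣legendre∣≤1 ℓ x =
  if-elim (λ z → ∣ z ∣ ≤ 1) ⌊ ℓ ∣? ∣ x ∣ ⌋ z≤n (if-elim (λ z → ∣ z ∣ ≤ 1) (isSquareMod ℓ x) ≤-refl ≤-refl)

∣^∣≤1 : ∀ x j → ∣ x ∣ ≤ 1 → ∣ x ℤ.^ j ∣ ≤ 1
∣^∣≤1 x zero    _      = ≤-refl
∣^∣≤1 x (suc j) ∣x∣≤1 = ≤-trans (≤-reflexive (ℤₚ.abs-* x (x ℤ.^ j))) (*-mono-≤ ∣x∣≤1 (∣^∣≤1 x j ∣x∣≤1))

∣localε∣≤ : ∀ ℓ .{{_ : NonZero ℓ}} u vβ γ → ∣ localε ℓ u vβ γ ∣ ≤ ℓ ^ u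
∣localε∣≤ ℓ u vβ γ = if-elim Bounded ⌊ u % 2 ≟ 0 ⌋
  (if-elim Bounded ⌊ u ≤? vβ ⌋ (totient≤ (ℓ ^ u))
    (if-elim Bounded ⌊ vβ + 1 ≟ u ⌋
      (≤-trans (≤-reflexive (ℤₚ.∣-i∣≡∣i∣ (+ (ℓ ^ (u ∸ 1))))) (^-monoʳ-≤ ℓ (m∸n≤m u 1))) z≤n))
  (if-elim Bounded ⌊ vβ + 1 ≟ u ⌋ (≤-trans (∣legendre∣≤1 ℓ (- γ)) (m^n>0 ℓ u)) z≤n)
  where
  Bounded : ℤ → Set
  Bounded z = ∣ z ∣ ≤ ℓ ^ u

∣coeff-localC∣≤ : ∀ ℓ .{{_ : NonZero ℓ}} u v vβ γ → ∣ coeff (localC ℓ u v vβ γ) ∣ ≤ ℓ ^ u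
∣coeff-localC∣≤ ℓ u v vβ γ = begin
    ∣ legendre ℓ γ ℤ.^ j ℤ.* localε ℓ u vβ γ ∣
  ≡⟨ ℤₚ.abs-* (legendre ℓ γ ℤ.^ j) (localε ℓ u vβ γ) ⟩
    ∣ legendre ℓ γ ℤ.^ j ∣ * ∣ localε ℓ u vβ γ ∣
  ≤⟨ *-mono-≤ (∣^∣≤1 (legendre ℓ γ) j (∣legendre∣≤1 ℓ γ)) (∣localε∣≤ ℓ u vβ γ) ⟩
    1 * ℓ ^ u
  ≡⟨ *-identityˡ (ℓ ^ u) ⟩
    ℓ ^ u ∎
  where
  open ≤-Reasoning
  j = u + 2 * v ∸ vβ ⊓ (u + 2 * v)

coeff-localC-vanishes : ∀ ℓ {u} v {vβ} γ → suc vβ < u → coeff (localC ℓ u v vβ γ) ≡ + 0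
coeff-localC-vanishes ℓ {u} v {vβ} γ 1+vβ<u =
  trans (cong (legendre ℓ γ ℤ.^ j ℤ.*_) (localε-vanishes ℓ γ 1+vβ<u)) (ℤₚ.*-zeroʳ (legendre ℓ γ ℤ.^ j))
  where j = u + 2 * v ∸ vβ ⊓ (u + 2 * v)

^-split : ∀ ℓ u v w → ℓ ^ (u + 2 * v + w) ≡ ℓ ^ u * (ℓ ^ v * ℓ ^ v) * ℓ ^ w
^-split ℓ u v w = begin
    ℓ ^ (u + 2 * v + w)
  ≡⟨ ^-distribˡ-+-* ℓ (u + 2 * v) w ⟩
    ℓ ^ (u + 2 * v) * ℓ ^ w
  ≡⟨ cong (_* ℓ ^ w) (^-distribˡ-+-* ℓ u (2 * v)) ⟩
    ℓ ^ u * ℓ ^ (v + (v + 0)) * ℓ ^ w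
  ≡⟨ cong (λ e → ℓ ^ u * ℓ ^ (v + e) * ℓ ^ w) (+-identityʳ v) ⟩
    ℓ ^ u * ℓ ^ (v + v) * ℓ ^ w
  ≡⟨ cong (λ z → ℓ ^ u * z * ℓ ^ w) (^-distribˡ-+-* ℓ v v) ⟩
    ℓ ^ u * (ℓ ^ v * ℓ ^ v) * ℓ ^ w ∎
  where open ≡-Reasoning

absSq-localC≤ : ∀ ℓ .{{_ : NonZero ℓ}} u v vβ γ →
  absSq (localC ℓ u v vβ γ) ≤ (ℓ ^ u) ^ 3 * (ℓ ^ v * ℓ ^ v) * ℓ ^ (vβ ⊓ (u + 2 * v))
absSq-localC≤ ℓ u v vβ γ = begin
    ∣ c ∣ * ∣ c ∣ * ℓ ^ (u + 2 * v + w)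
  ≤⟨ *-monoˡ-≤ (ℓ ^ (u + 2 * v + w)) (*-mono-≤ ∣c∣≤ ∣c∣≤) ⟩
    ℓ ^ u * ℓ ^ u * ℓ ^ (u + 2 * v + w)
  ≡⟨ cong (ℓ ^ u * ℓ ^ u *_) (^-split ℓ u v w) ⟩
    ℓ ^ u * ℓ ^ u * (ℓ ^ u * (ℓ ^ v * ℓ ^ v) * ℓ ^ w)
  ≡⟨ regroup (ℓ ^ u) (ℓ ^ v) (ℓ ^ w) ⟩
    (ℓ ^ u) ^ 3 * (ℓ ^ v * ℓ ^ v) * ℓ ^ w ∎
  where
  open ≤-Reasoning
  c = coeff (localC ℓ u v vβ γ)
  w = vβ ⊓ (u + 2 * v)
  ∣c∣≤ = ∣coeff-localC∣≤ ℓ u v vβ γ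
  regroup : ∀ a b d → a * a * (a * (b * b) * d) ≡ a * (a * (a * 1)) * (b * b) * d
  regroup = solve-∀

-- Denominators

abs-cong-* : ∀ i j {m} → i ℤ.* j ≡ m → ∣ i ∣ * ∣ j ∣ ≡ ∣ m ∣
abs-cong-* i j refl = sym (ℤₚ.abs-* i j)

coprime-↥↧ : ∀ q → Coprime ∣ ↥ q ∣ (↧ₙ q)
coprime-↥↧ (ℚ.mkℚ _ _ c) = recompute c

↥↧-1/ : ∀ d .{{_ : NonZero d}} → ∣ ↥ (+ 1 ℚ./ d) ∣ ≡ 1 × ↧ₙ (+ 1 ℚ./ d) ≡ d
↥↧-1/ d = m*n≡1⇒m≡1 ∣ ↥ (+ 1 ℚ./ d) ∣ g ↥*g≡1 , ↧≡d
  where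
  g : ℕ
  g = ∣ gcd (+ 1) (+ d) ∣
  ↥*g≡1 : ∣ ↥ (+ 1 ℚ./ d) ∣ * g ≡ 1
  ↥*g≡1 = abs-cong-* (↥ (+ 1 ℚ./ d)) (gcd (+ 1) (+ d)) (ℚₚ.↥-/ (+ 1) d)
  ↧≡d : ↧ₙ (+ 1 ℚ./ d) ≡ d
  ↧≡d = begin
      ↧ₙ (+ 1 ℚ./ d)         ≡⟨ sym (*-identityʳ _) ⟩
      ↧ₙ (+ 1 ℚ./ d) * 1     ≡⟨ cong (↧ₙ (+ 1 ℚ./ d) *_) (sym (m*n≡1⇒n≡1 ∣ ↥ (+ 1 ℚ./ d) ∣ g ↥*g≡1)) ⟩
      ↧ₙ (+ 1 ℚ./ d) * g     ≡⟨ abs-cong-* (ℚ.↧ (+ 1 ℚ./ d)) (gcd (+ 1) (+ d)) (ℚₚ.↧-/ (+ 1) d) ⟩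
      d                      ∎
    where open ≡-Reasoning

↥↧-*1/ : ∀ α d .{{_ : NonZero d}} → ∃[ c ]
  ∣ ↥ (α ℚ.* (+ 1 ℚ./ d)) ∣ * c ≡ ∣ ↥ α ∣ × ↧ₙ (α ℚ.* (+ 1 ℚ./ d)) * c ≡ ↧ₙ α * d
↥↧-*1/ α d = ∣ g ∣ , ↥-eq , ↧-eq
  where
  β = + 1 ℚ./ d
  g = gcd (↥ α ℤ.* ↥ β) (ℚ.↧ α ℤ.* ℚ.↧ β)
  ↥-eq : ∣ ↥ (α ℚ.* β) ∣ * ∣ g ∣ ≡ ∣ ↥ α ∣
  ↥-eq = begin
    ∣ ↥ (α ℚ.* β) ∣ * ∣ g ∣  ≡⟨ abs-cong-* (↥ (α ℚ.* β)) g (ℚₚ.↥-* α β) ⟩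
    ∣ ↥ α ℤ.* ↥ β ∣          ≡⟨ ℤₚ.abs-* (↥ α) (↥ β) ⟩
    ∣ ↥ α ∣ * ∣ ↥ β ∣        ≡⟨ cong (∣ ↥ α ∣ *_) (proj₁ (↥↧-1/ d)) ⟩
    ∣ ↥ α ∣ * 1              ≡⟨ *-identityʳ _ ⟩
    ∣ ↥ α ∣                  ∎
    where open ≡-Reasoning
  ↧-eq : ↧ₙ (α ℚ.* β) * ∣ g ∣ ≡ ↧ₙ α * d
  ↧-eq = trans (abs-cong-* (ℚ.↧ (α ℚ.* β)) g (ℚₚ.↧-* α β)) (cong (↧ₙ α *_) (proj₂ (↥↧-1/ d)))

prime^∣↧[α/d] : ∀ α {ℓ a} d .{{_ : NonZero d}} → Prime ℓ → ¬ ℓ ∣ ↧ₙ α → ℓ ^ a ∣ ∣ ↥ α ∣ →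
  ℓ ∣ ↧ₙ (α ℚ.* (+ 1 ℚ./ d)) → ℓ ^ suc a ∣ d
prime^∣↧[α/d] α {ℓ} {a} d pℓ ℓ∤↧α ℓ^a∣↥α ℓ∣↧γ with ↥↧-*1/ α d
... | c , ↥γ*c≡↥α , ↧γ*c≡↧α*d =
  prime^∣m*n⇒∣n d (suc a) pℓ ℓ∤↧α (subst (ℓ ^ suc a ∣_) ↧γ*c≡↧α*d (*-pres-∣ ℓ∣↧γ ℓ^a∣c))
  where
  γ = α ℚ.* (+ 1 ℚ./ d)
  ℓ∤↥γ : ¬ ℓ ∣ ∣ ↥ γ ∣
  ℓ∤↥γ ℓ∣↥γ = ¬prime[1] (subst Prime (coprime-↥↧ γ (ℓ∣↥γ , ℓ∣↧γ)) pℓ)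
  ℓ^a∣c : ℓ ^ a ∣ c
  ℓ^a∣c = prime^∣m*n⇒∣n c a pℓ ℓ∤↥γ (subst (ℓ ^ a ∣_) (sym ↥γ*c≡↥α) ℓ^a∣↥α)

InZS-*1/ : ∀ {S} α d {k r} .{{_ : NonZero d}} .{{_ : NonZero k}} → InZS S α → d * r ≡ k →
  (∀ {ℓ} → Prime ℓ → ℓ ∣ k → ℓ ∣ r) →
  (∀ {ℓ} → Prime ℓ → ℓ ∉ S → ℓ ∣ k → val ℓ k ≤ suc (valQ ℓ α)) →
  InZS S (α ℚ.* (+ 1 ℚ./ d))
InZS-*1/ {S} α d {k} {r} α∈ℤˢ d*r≡k ℓ∣k⇒ℓ∣r val≤ ℓ pℓ ℓ∉S ℓ∣↧γ =
  n≮n u (^∣⇒≤val (prime>1 pℓ) ℓ^[1+u]∣k)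
  where
  ℓ∤↧α = α∈ℤˢ ℓ pℓ ℓ∉S
  ℓ∣k : ℓ ∣ k
  ℓ∣k = ∣-trans (subst (_∣ d) (*-identityʳ ℓ) (prime^∣↧[α/d] α {a = 0} d pℓ ℓ∤↧α (1∣ _) ℓ∣↧γ))
                (subst (d ∣_) d*r≡k (m∣m*n r))
  u = val ℓ k
  1≤u : 1 ≤ u
  1≤u = ^∣⇒≤val (prime>1 pℓ) (subst (_∣ k) (sym (*-identityʳ ℓ)) ℓ∣k)
  ℓ^[u-1]∣↥α : ℓ ^ (u ∸ 1) ∣ ∣ ↥ α ∣
  ℓ^[u-1]∣↥α = ∣-trans (^-monoʳ-∣ ℓ (m≤n+o⇒m∸n≤o u 1 (val≤ pℓ ℓ∉S ℓ∣k))) (^val∣ ℓ ∣ ↥ α ∣)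
  ℓ^u∣d : ℓ ^ u ∣ d
  ℓ^u∣d = subst (λ e → ℓ ^ e ∣ d) (m+[n∸m]≡n 1≤u) (prime^∣↧[α/d] α {a = u ∸ 1} d pℓ ℓ∤↧α ℓ^[u-1]∣↥α ℓ∣↧γ)
  ℓ^[1+u]∣k : ℓ ^ suc u ∣ k
  ℓ^[1+u]∣k = subst₂ _∣_ (*-comm (ℓ ^ u) ℓ) d*r≡k (*-pres-∣ ℓ^u∣d (ℓ∣k⇒ℓ∣r pℓ ℓ∣k))

DivS-k/radical : ∀ S α k .{{_ : NonZero k}} → InZS S α →
  (∀ {ℓ} → Prime ℓ → ℓ ∉ S → ℓ ∣ k → val ℓ k ≤ suc (valQ ℓ α)) → DivS S (divN k (radical k)) α
DivS-k/radical S α k α∈ℤˢ val≤ with divN k (radical k) | divN*≡ (radical∣ k)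
... | zero  | 0≡k   = contradiction (sym 0≡k) (ℕ.≢-nonZero⁻¹ k)
... | suc d | d*r≡k = InZS-*1/ α (suc d) α∈ℤˢ d*r≡k (prime∣⇒∣radical k) val≤

-- Bounds and vanishing of c_{k,f}

module _ (k f : ℕ) .{{_ : NonZero k}} .{{_ : NonZero f}} (α : ℚ) where

  private
    instance
      k*f≢0 : NonZero (k * f)
      k*f≢0 = m*n≢0 k f
      k*f*f≢0 : NonZero (k * f * f)
      k*f*f≢0 = m*n≢0 (k * f) f

  -- The residue that cLocal passes to localC, so that cLocal ℓ k f α unfolds to
  -- localC ℓ (val ℓ k) (val ℓ f) (valQ ℓ α) (residue ℓ).
  residue : ℕ → ℤ
  residue ℓ =
    unitPart ℓ (valQ ℓ α) (↥ α) ℤ.* (+ invMod (ℓ ^ e) (divN (k * f * f) (ℓ ^ e))) ℤ.* (+ invMod ℓ (↧ₙ α))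
    where e = val ℓ k + 2 * val ℓ f

  val-k*f*f-≥ : ∀ {ℓ} → 1 < ℓ → val ℓ k + 2 * val ℓ f ≤ val ℓ (k * f * f)
  val-k*f*f-≥ {ℓ} 1<ℓ = begin
      val ℓ k + 2 * val ℓ f
    ≡⟨ cong (λ x → val ℓ k + (val ℓ f + x)) (+-identityʳ (val ℓ f)) ⟩
      val ℓ k + (val ℓ f + val ℓ f)
    ≡⟨ sym (+-assoc (val ℓ k) (val ℓ f) (val ℓ f)) ⟩
      val ℓ k + val ℓ f + val ℓ f
    ≤⟨ +-monoˡ-≤ (val ℓ f) (val-*-≥ k f 1<ℓ) ⟩
      val ℓ (k * f) + val ℓ f
    ≤⟨ val-*-≥ (k * f) f 1<ℓ ⟩
      val ℓ (k * f * f) ∎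
    where open ≤-Reasoning

  absSq-cLocal≤ : ∀ {ℓ} → Prime ℓ →
    absSq (cLocal ℓ k f α)
      ≤ (ℓ ^ val ℓ k) ^ 3 * (ℓ ^ val ℓ f * ℓ ^ val ℓ f) * ℓ ^ (valQ ℓ α ⊓ val ℓ (k * f * f))
  absSq-cLocal≤ {ℓ} pℓ = ≤-trans (absSq-localC≤ ℓ u v vα (residue ℓ))
    (*-monoʳ-≤ ((ℓ ^ u) ^ 3 * (ℓ ^ v * ℓ ^ v)) (^-monoʳ-≤ ℓ (⊓-monoʳ-≤ vα (val-k*f*f-≥ (prime>1 pℓ)))))
    where
    instance _ = prime⇒nonZero pℓ
    u = val ℓ k
    v = val ℓ f
    vα = valQ ℓ α

  absSq-cKF≤ : ∀ S → absSq (cKF S k f α) ≤ k ^ 3 * (f * f) * gcdS S k f α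
  absSq-cKF≤ S = begin
      absSq (cKF S k f α)
    ≡⟨ absSq-∏V (λ ℓ → cLocal ℓ k f α) L ⟩
      ∏ (λ ℓ → absSq (cLocal ℓ k f α)) L
    ≤⟨ ∏-mono-≤ L (All.map absSq-cLocal≤ (primesOutside-prime S (k * f))) ⟩
      ∏ (λ ℓ → (ℓ ^ val ℓ k) ^ 3 * (ℓ ^ val ℓ f * ℓ ^ val ℓ f) * ℓ ^ w ℓ) L
    ≡⟨ ∏-monomial (λ ℓ → ℓ ^ val ℓ k) (λ ℓ → ℓ ^ val ℓ f) (λ ℓ → ℓ ^ w ℓ) L ⟩
      Pk ^ 3 * (Pf * Pf) * ∏ (λ ℓ → ℓ ^ w ℓ) L
    ≤⟨ *-mono-≤ (*-mono-≤ (^-monoˡ-≤ 3 (∣⇒≤ (∏^val∣ k))) (*-mono-≤ (∣⇒≤ (∏^val∣ f)) (∣⇒≤ (∏^val∣ f))))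
                (∏^-primesOutside-mono S w (m≤m*n (k * f) f)) ⟩
      k ^ 3 * (f * f) * gcdS S k f α ∎
    where
    open ≤-Reasoning
    L = primesOutside S (k * f)
    w = λ ℓ → valQ ℓ α ⊓ val ℓ (k * f * f)
    ∏^val∣ : ∀ n → ∏ (λ ℓ → ℓ ^ val ℓ n) L ∣ n
    ∏^val∣ n = ∏^∣ (λ ℓ → val ℓ n) L (primesOutside-prime S (k * f)) (primesOutside-unique S (k * f))
                   (All.tabulate (λ {ℓ} _ → ^val∣ ℓ n))
    Pk = ∏ (λ ℓ → ℓ ^ val ℓ k) L
    Pf = ∏ (λ ℓ → ℓ ^ val ℓ f) L

  cKF-vanishes : ∀ S → InZS S α → ¬ DivS S (divN k (radical k)) α → IsZero (cKF S k f α)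
  cKF-vanishes S α∈ℤˢ ¬k/radk∣α with any? (λ ℓ → suc (valQ ℓ α) <? val ℓ k) (primesOutside S (k * f))
  ... | yes some = inj₁ (coeff-∏V-vanishes (λ ℓ → cLocal ℓ k f α)
                           (Any.map (λ {ℓ} → coeff-localC-vanishes ℓ (val ℓ f) (residue ℓ)) some))
  ... | no none  = contradiction (DivS-k/radical S α k α∈ℤˢ val≤) ¬k/radk∣α
    where
    val≤ : ∀ {ℓ} → Prime ℓ → ℓ ∉ S → ℓ ∣ k → val ℓ k ≤ suc (valQ ℓ α)
    val≤ pℓ ℓ∉S ℓ∣k = ≮⇒≥ (All.lookup (¬Any⇒All¬ _ none)
                        (∈-primesOutside S pℓ ℓ∉S (≤-trans (∣⇒≤ ℓ∣k) (m≤m*n k f))))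

proposition4p5 : (S : List ℕ) → All Prime S → Unique S → 2 ∈ S →
    (α : ℚ) → InZS S α → α ≢ 0ℚ →
    (k f : ℕ) → NonZero k → NonZero f →
    All (λ q → Coprime q k) S → All (λ q → Coprime q f) S →
    (¬ DivS S (divN k (radical k)) α → IsZero (cKF S k f α))
    × (DivS S (divN k (radical k)) α →
        absSq (cKF S k f α) ≤ k ^ 3 * (f * f) * gcdS S k f α)
proposition4p5 S _ _ _ α α∈ℤˢ _ k f k≢0 f≢0 _ _ =
  cKF-vanishes k f {{k≢0}} {{f≢0}} α S α∈ℤˢ , λ _ → absSq-cKF≤ k f {{k≢0}} {{f≢0}} α S
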